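{- Let $k\geq2$. For every $M\in\{1,2,\dots\}\cup\{\infty\}$ and every $N\in\{0,1,2,\dots\}$, the non-oriented spider-web graph $SW_{k,N,M}$ is weakly isomorphic (isomorphic as graphs, ignoring labels) to the non-oriented Schreier graph $\mathrm{Sch}(\mathcal L_k,H_{N,M},X_k)$.
   Context: Loops and multiple edges allowed. The oriented spider-web graph $\vec{SW}_{k,N,M}$ has vertex set $\{0,\dots,k-1\}^N\times\mathbb Z/M\mathbb Z$ (with $\mathbb Z/\infty\mathbb Z:=\mathbb Z$) and, for each vertex $(x_1\dots x_N,i)$ and each $y\in\{0,\dots,k-1\}$, one edge from $(x_1\dots x_N,i)$ to $(x_2\dots x_Ny,i+1)$; $SW_{k,N,M}$ is its underlying non-oriented graph (each edge gets a formal inverse). $\mathcal L_k=(\mathbb Z/k\mathbb Z)\wr\mathbb Z$, with $b$ the generator of $\mathbb Z$ acting by shift and $c$ the generator of the copy of $\mathbb Z/k\mathbb Z$ at coordinate 0; $X_k=\{c^rb:0\le r\le k-1\}$. Every $g\in\mathcal L_k$ can be written $g=\prod_{t=1}^j(b^{i_t}cb^{ -i_t})^{r_t}\cdot b^{r_b}$ with integers $i_t,r_t,r_b$, where $r_b$ is uniquely determined and, for each $i\in\mathbb Z$, $\sum_{t:i_t=i}r_t$ is uniquely determined mod $k$. $H_{N,M}$ is the subgroup of those $g$ with $r_b\equiv0\pmod M$ (meaning $r_b=0$ if $M=\infty$) and, for every $1\le i\le N$, $\sum_{t:\,i_t\equiv i\ (\mathrm{mod}\ N)}r_t\equiv0\pmod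 k$. For $H\le G$ and generating set $S$, the oriented Schreier graph has vertex set the right cosets $Hg$ and an edge labeled $s$ from $Hg$ to $Hgs$ for each $s\in S$; the non-oriented Schreier graph $\mathrm{Sch}(G,H,S)$ is its underlying non-oriented graph. -}

module Defs where

open import Data.Nat as ℕ using (ℕ; NonZero; _≤_)
open import Data.Nat.DivMod using (_mod_)
open import Data.Fin using (Fin; toℕ)
open import Data.Integer as ℤ using (ℤ; +_; 0ℤ)
open import Data.Integer.Divisibility.Signed using (_∣_; _∣?_)
open import Data.List using (List; []; _∷_; _++_; map; foldr; [_])
open import Data.Vec using (Vec; []; _∷_; _∷ʳ_)
open import Data.Product using (_×_; _,_; proj₁; proj₂)
open import Data.Sum using (_⊎_; inj₁; inj₂)
open import Data.Empty using (⊥)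
open import Relation.Nullary.Decidable using (does)
open import Data.Bool using (if_then_else_)
open import Relation.Binary.PropositionalEquality using (_≡_)

-- Graphs (loops and multiple edges allowed), possibly with vertex/edge
-- sets given up to a relation (needed for coset spaces, since Agda has
-- no quotient types).

record Graph : Set₁ where
  field
    V    : Set
    _≈V_ : V → V → Set
    E    : Set
    _≈E_ : E → E → Set
    src  : E → V
    tgt  : E → V

module _ (G : Graph) where
  open Graph G

  -- underlying non-oriented graph: each edge e gets a formal inverse;
  -- darts are  inj₁ e  (= e) and  inj₂ e  (= e⁻¹).
  Dart : Set
  Dart = E ⊎ E

  _≈D_ : Dart → Dart → Set
  inj₁ e ≈D inj₁ e′ = e ≈E e′
  inj₂ e ≈D inj₂ e′ = e ≈E e′
  inj₁ _ ≈D inj₂ _  = ⊥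
  inj₂ _ ≈D inj₁ _  = ⊥

  origin : Dart → V
  origin (inj₁ e) = src e
  origin (inj₂ e) = tgt e

  terminus : Dart → V
  terminus (inj₁ e) = tgt e
  terminus (inj₂ e) = src e

  rev : Dart → Dart
  rev (inj₁ e) = inj₂ e
  rev (inj₂ e) = inj₁ e

record WeakIso (G H : Graph) : Set where
  module G = Graph G
  module H = Graph H
  field
    φ       : G.V → H.V
    φ⁻¹     : H.V → G.V
    φ-cong  : ∀ {x y} → G._≈V_ x y → H._≈V_ (φ x) (φ y)
    φ⁻¹-cong : ∀ {x y} → H._≈V_ x y → G._≈V_ (φ⁻¹ x) (φ⁻¹ y)
    φ⁻¹∘φ   : ∀ x → G._≈V_ (φ⁻¹ (φ x)) x
    φ∘φ⁻¹   : ∀ y → H._≈V_ (φ (φ⁻¹ y)) y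
    ψ       : Dart G → Dart H
    ψ⁻¹     : Dart H → Dart G
    ψ-cong  : ∀ {d d′} → _≈D_ G d d′ → _≈D_ H (ψ d) (ψ d′)
    ψ⁻¹-cong : ∀ {d d′} → _≈D_ H d d′ → _≈D_ G (ψ⁻¹ d) (ψ⁻¹ d′)
    ψ⁻¹∘ψ   : ∀ d → _≈D_ G (ψ⁻¹ (ψ d)) d
    ψ∘ψ⁻¹   : ∀ d → _≈D_ H (ψ (ψ⁻¹ d)) d
    ψ-origin   : ∀ d → H._≈V_ (origin H (ψ d)) (φ (origin G d))
    ψ-terminus : ∀ d → H._≈V_ (terminus H (ψ d)) (φ (terminus G d))
    ψ-rev      : ∀ d → _≈D_ H (ψ (rev G d)) (rev H (ψ d))

data Modulus : Set where
  fin : (m : ℕ) → .{{NonZero m}} → Modulus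
  ∞   : Modulus

ZMod : Modulus → Set
ZMod (fin m) = Fin m
ZMod ∞       = ℤ

sucMod : (M : Modulus) → ZMod M → ZMod M
sucMod (fin m) i = ℕ.suc (toℕ i) mod m
sucMod ∞       i = ℤ.suc i

shiftIn : ∀ {A : Set} {N} → Vec A N → A → Vec A N
shiftIn []       y = []
shiftIn (x ∷ xs) y = xs ∷ʳ y

SWVertex : ℕ → ℕ → Modulus → Set
SWVertex k N M = Vec (Fin k) N × ZMod M

SW : (k N : ℕ) → Modulus → Graph
SW k N M = record
  { V    = SWVertex k N M
  ; _≈V_ = _≡_
  ; E    = SWVertex k N M × Fin k
  ; _≈E_ = _≡_
  ; src  = proj₁
  ; tgt  = λ { ((x , i) , y) → (shiftIn x y , sucMod M i) }
  }

-- The lamplighter group  L_k = (ℤ/kℤ) ≀ ℤ, elements in the normal form of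
-- the paper:  g = ∏_{t=1}^{j} (b^{i_t} c b^{-i_t})^{r_t} · b^{r_b},
-- stored as (list of pairs (i_t , r_t) , r_b).

LWord : Set
LWord = List (ℤ × ℤ) × ℤ

-- b^m (b^i c b^{-i}) b^{-m} = b^{i+m} c b^{-(i+m)}
shiftLamps : ℤ → List (ℤ × ℤ) → List (ℤ × ℤ)
shiftLamps m = map (λ { (i , r) → (i ℤ.+ m , r) })

_·_ : LWord → LWord → LWord
(L , m) · (L′ , m′) = (L ++ shiftLamps m L′ , m ℤ.+ m′)

inv : LWord → LWord
inv (L , m) = (map (λ { (i , r) → (i ℤ.- m , ℤ.- r) }) L , ℤ.- m)

gen : ∀ {k} → Fin k → LWord
gen r = ([ (0ℤ , + toℕ r) ] , ℤ.+ 1)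

sumℤ : List ℤ → ℤ
sumℤ = foldr ℤ._+_ 0ℤ

lampSum : ℕ → List (ℤ × ℤ) → ℤ → ℤ
lampSum N L i =
  sumℤ (map (λ { (j , r) → if does ((+ N) ∣? (j ℤ.- i)) then r else 0ℤ }) L)

ShiftCond : Modulus → ℤ → Set
ShiftCond (fin m) rb = (+ m) ∣ rb
ShiftCond ∞       rb = rb ≡ 0ℤ

InH : (k N : ℕ) → Modulus → LWord → Set
InH k N M (L , rb) =
  ShiftCond M rb ×
  (∀ (i : ℕ) → 1 ≤ i → i ≤ N → (+ k) ∣ lampSum N L (+ i))

-- same right coset:  H g = H h  ⇔  g h⁻¹ ∈ H
SameCoset : (k N : ℕ) → Modulus → LWord → LWord → Set
SameCoset k N M g h = InH k N M (g · inv h)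

-- Oriented Schreier graph of (L_k, H_{N,M}, X_k): vertices the right cosets
-- H g (represented by g, up to SameCoset), an edge labelled s from H g to
-- H g s for each s ∈ X_k.
Sch : (k N : ℕ) → Modulus → Graph
Sch k N M = record
  { V    = LWord
  ; _≈V_ = SameCoset k N M
  ; E    = LWord × Fin k
  ; _≈E_ = λ { (g , r) (h , r′) → SameCoset k N M g h × r ≡ r′ }
  ; src  = proj₁
  ; tgt  = λ { (g , r) → g · gen r }
  }

-- A word g = (lamps , r_b) of L_k determines a vertex of SW_{k,N,M}: its window x,
-- where x_q is the total value mod k of the lamps at positions ≡ r_b + q (mod N),
-- together with r_b mod M.  Since {1, …, N} and {r_b, …, r_b + N − 1} are both
-- complete residue systems mod N, the definition of H_{N,M} says exactly that two
-- words lie in the same right coset iff they determine the same vertex; and every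
-- vertex (x , i) arises, from the word with lamps x at positions i, …, i + N − 1 and
-- the lighter at i.  Right multiplication by c^r b adds r to the lamp under the
-- lighter and moves the lighter one step, i.e. shifts the window and appends x₁ + r.
-- So the Schreier edge labelled r at the coset of (x , i) is the spider-web edge
-- appending y = x₁ + r, and y ↦ y − x₁ matches the out-edges of each vertex.  This
-- is an isomorphism of oriented graphs, hence of the underlying non-oriented graphs.

module Submission where

open import Defs
open import Data.Nat as ℕ using (ℕ; zero; suc; _≤_; _<_; z≤n; s≤s; NonZero)
import Data.Nat.Properties as ℕP
import Data.Nat.Divisibility as ℕ∣
open import Data.Nat.DivMod using (m<n⇒m%n≡m)
open import Data.Integer using (ℤ; +_; 0ℤ; _+_; _-_; -_; _*_)
import Data.Integer.Properties as ℤP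
open import Data.Integer.DivMod using (_%ℕ_; _/ℕ_; n%ℕd<d; a≡a%ℕn+[a/ℕn]*n)
open import Data.Integer.Divisibility.Signed using (_∣_; divides; _∣?_; ∣m⇒∣-m; ∣m∣n⇒∣m+n; ∣⇒∣ᵤ)
open import Data.Integer.Tactic.RingSolver using (solve-∀)
open import Data.Fin as Fin using (Fin; toℕ; fromℕ<; fromℕ; inject₁)
import Data.Fin.Properties as FinP
open import Data.Vec using (Vec; []; _∷_; _∷ʳ_; lookup; tabulate)
import Data.Vec.Properties as VecP
open import Data.List using (List; []; _∷_; _++_)
open import Data.Product using (_×_; _,_; proj₁; proj₂)
import Data.Sum as Sum
open import Data.Sum using (inj₁; inj₂)
open import Data.Bool using (true; false; if_then_else_)
open import Data.Empty using (⊥-elim)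
open import Relation.Nullary using (¬_; Dec; yes; no)
import Relation.Nullary.Decidable as Dec
open import Relation.Nullary.Decidable using (dec-true; dec-false)
open import Function.Base using (_∘_)
open import Function.Bundles using (_⇔_; mk⇔; module Equivalence)
open Equivalence using (to; from)
open import Relation.Binary.PropositionalEquality

record OrientedIso (G H : Graph) : Set where
  private
    module G = Graph G
    module H = Graph H
  field
    φ        : G.V → H.V
    φ⁻¹      : H.V → G.V
    φ-cong   : ∀ {x y} → G._≈V_ x y → H._≈V_ (φ x) (φ y)
    φ⁻¹-cong : ∀ {x y} → H._≈V_ x y → G._≈V_ (φ⁻¹ x) (φ⁻¹ y)
    φ⁻¹∘φ    : ∀ x → G._≈V_ (φ⁻¹ (φ x)) x
    φ∘φ⁻¹    : ∀ y → H._≈V_ (φ (φ⁻¹ y)) y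
    ε        : G.E → H.E
    ε⁻¹      : H.E → G.E
    ε-cong   : ∀ {e e′} → G._≈E_ e e′ → H._≈E_ (ε e) (ε e′)
    ε⁻¹-cong : ∀ {e e′} → H._≈E_ e e′ → G._≈E_ (ε⁻¹ e) (ε⁻¹ e′)
    ε⁻¹∘ε    : ∀ e → G._≈E_ (ε⁻¹ (ε e)) e
    ε∘ε⁻¹    : ∀ e → H._≈E_ (ε (ε⁻¹ e)) e
    ε-src    : ∀ e → H._≈V_ (H.src (ε e)) (φ (G.src e))
    ε-tgt    : ∀ e → H._≈V_ (H.tgt (ε e)) (φ (G.tgt e))

orientedIso⇒weakIso : ∀ {G H} → OrientedIso G H → (∀ e → Graph._≈E_ H e e) → WeakIso G H
orientedIso⇒weakIso {G} {H} iso ≈E-refl = record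
  { φ          = φ
  ; φ⁻¹        = φ⁻¹
  ; φ-cong     = φ-cong
  ; φ⁻¹-cong   = φ⁻¹-cong
  ; φ⁻¹∘φ      = φ⁻¹∘φ
  ; φ∘φ⁻¹      = φ∘φ⁻¹
  ; ψ          = ψ
  ; ψ⁻¹        = ψ⁻¹
  ; ψ-cong     = λ {d} {d′} → ψ-cong {d} {d′}
  ; ψ⁻¹-cong   = λ {d} {d′} → ψ⁻¹-cong {d} {d′}
  ; ψ⁻¹∘ψ      = ψ⁻¹∘ψ
  ; ψ∘ψ⁻¹      = ψ∘ψ⁻¹
  ; ψ-origin   = ψ-origin
  ; ψ-terminus = ψ-terminus
  ; ψ-rev      = ψ-rev
  }
  where
  open OrientedIso iso

  ψ : Dart G → Dart H
  ψ = Sum.map ε ε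

  ψ⁻¹ : Dart H → Dart G
  ψ⁻¹ = Sum.map ε⁻¹ ε⁻¹

  ψ-cong : ∀ {d d′} → _≈D_ G d d′ → _≈D_ H (ψ d) (ψ d′)
  ψ-cong {inj₁ _} {inj₁ _} = ε-cong
  ψ-cong {inj₂ _} {inj₂ _} = ε-cong
  ψ-cong {inj₁ _} {inj₂ _} ()
  ψ-cong {inj₂ _} {inj₁ _} ()

  ψ⁻¹-cong : ∀ {d d′} → _≈D_ H d d′ → _≈D_ G (ψ⁻¹ d) (ψ⁻¹ d′)
  ψ⁻¹-cong {inj₁ _} {inj₁ _} = ε⁻¹-cong
  ψ⁻¹-cong {inj₂ _} {inj₂ _} = ε⁻¹-cong
  ψ⁻¹-cong {inj₁ _} {inj₂ _} ()
  ψ⁻¹-cong {inj₂ _} {inj₁ _} ()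

  ψ⁻¹∘ψ : ∀ d → _≈D_ G (ψ⁻¹ (ψ d)) d
  ψ⁻¹∘ψ (inj₁ e) = ε⁻¹∘ε e
  ψ⁻¹∘ψ (inj₂ e) = ε⁻¹∘ε e

  ψ∘ψ⁻¹ : ∀ d → _≈D_ H (ψ (ψ⁻¹ d)) d
  ψ∘ψ⁻¹ (inj₁ e) = ε∘ε⁻¹ e
  ψ∘ψ⁻¹ (inj₂ e) = ε∘ε⁻¹ e

  ψ-origin : ∀ d → Graph._≈V_ H (origin H (ψ d)) (φ (origin G d))
  ψ-origin (inj₁ e) = ε-src e
  ψ-origin (inj₂ e) = ε-tgt e

  ψ-terminus : ∀ d → Graph._≈V_ H (terminus H (ψ d)) (φ (terminus G d))
  ψ-terminus (inj₁ e) = ε-tgt e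
  ψ-terminus (inj₂ e) = ε-src e

  ψ-rev : ∀ d → _≈D_ H (ψ (rev G d)) (rev H (ψ d))
  ψ-rev (inj₁ e) = ≈E-refl (ε e)
  ψ-rev (inj₂ e) = ≈E-refl (ε e)

-- A record rather than an abbreviation of  + d ∣ a - b,  so that a and b are inferable.
infix 4 _≡_mod_
record _≡_mod_ (a b : ℤ) (d : ℕ) : Set where
  constructor ∣⇒≡mod
  field ≡mod⇒∣ : + d ∣ a - b
open _≡_mod_

_≡?_mod_ : ∀ a b d → Dec (a ≡ b mod d)
a ≡? b mod d = Dec.map′ ∣⇒≡mod ≡mod⇒∣ (+ d ∣? a - b)

module _ {d : ℕ} where

  ≡-mod-reflexive : ∀ {a b} → a ≡ b → a ≡ b mod d
  ≡-mod-reflexive {a} refl = ∣⇒≡mod (divides 0ℤ (ℤP.+-inverseʳ a))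

  ≡-mod-refl : ∀ {a} → a ≡ a mod d
  ≡-mod-refl = ≡-mod-reflexive refl

  ≡-mod-sym : ∀ {a b} → a ≡ b mod d → b ≡ a mod d
  ≡-mod-sym {a} {b} (∣⇒≡mod d∣a-b) = ∣⇒≡mod (subst (+ d ∣_) (negate a b) (∣m⇒∣-m d∣a-b))
    where
    negate : ∀ a b → - (a - b) ≡ b - a
    negate = solve-∀

  ≡-mod-trans : ∀ {a b c} → a ≡ b mod d → b ≡ c mod d → a ≡ c mod d
  ≡-mod-trans {a} {b} {c} (∣⇒≡mod d∣a-b) (∣⇒≡mod d∣b-c) =
    ∣⇒≡mod (subst (+ d ∣_) (ℤP.+-minus-telescope a b c) (∣m∣n⇒∣m+n d∣a-b d∣b-c))

  ≡-mod-+ : ∀ {a b c e} → a ≡ b mod d → c ≡ e mod d → a + c ≡ b + e mod d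
  ≡-mod-+ {a} {b} {c} {e} (∣⇒≡mod d∣a-b) (∣⇒≡mod d∣c-e) =
    ∣⇒≡mod (subst (+ d ∣_) (interchange a b c e) (∣m∣n⇒∣m+n d∣a-b d∣c-e))
    where
    interchange : ∀ a b c e → (a - b) + (c - e) ≡ (a + c) - (b + e)
    interchange = solve-∀

  +-period-≡-mod : ∀ a → + d + a ≡ a mod d
  +-period-≡-mod a = ∣⇒≡mod (divides (+ 1) (cancel (+ d) a))
    where
    cancel : ∀ d a → d + a - a ≡ + 1 * d
    cancel = solve-∀

  ≡-mod-offset⇒≡0 : ∀ {s a} → s < d → a ≡ + s + a mod d → s ≡ 0
  ≡-mod-offset⇒≡0 {zero}      _   _                  = refl
  ≡-mod-offset⇒≡0 {suc s} {a} s<d (∣⇒≡mod d∣a-[s+a]) =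
    ⊥-elim (ℕP.<⇒≱ s<d (ℕ∣.∣⇒≤ (∣⇒∣ᵤ (subst (+ d ∣_) (negate a (+ suc s)) (∣m⇒∣-m d∣a-[s+a])))))
    where
    negate : ∀ a s → - (a - (s + a)) ≡ s
    negate = solve-∀

≡-mod-≥⇒≡ : ∀ {d r s} → s ≤ r → r < d → + r ≡ + s mod d → r ≡ s
≡-mod-≥⇒≡ {d} {r} {s} s≤r r<d r≡s = ℕP.≤-antisym (ℕP.m∸n≡0⇒m≤n r∸s≡0) s≤r
  where
  r∸s≡0 : r ℕ.∸ s ≡ 0
  r∸s≡0 = ≡-mod-offset⇒≡0 (ℕP.≤-<-trans (ℕP.m∸n≤m r s) r<d)
    (subst (λ x → + s ≡ x mod d) (cong +_ (sym (ℕP.m∸n+n≡m s≤r))) (≡-mod-sym r≡s))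

≡-mod-small⇒≡ : ∀ {d r s} → r < d → s < d → + r ≡ + s mod d → r ≡ s
≡-mod-small⇒≡ {r = r} {s} r<d s<d r≡s with ℕP.≤-total s r
... | inj₁ s≤r = ≡-mod-≥⇒≡ s≤r r<d r≡s
... | inj₂ r≤s = sym (≡-mod-≥⇒≡ r≤s s<d (≡-mod-sym r≡s))

module _ (d : ℕ) .{{_ : NonZero d}} where

  residue : ℤ → Fin d
  residue a = fromℕ< (n%ℕd<d a d)

  residue-≡-mod : ∀ a → + toℕ (residue a) ≡ a mod d
  residue-≡-mod a = ∣⇒≡mod (divides (- (a /ℕ d)) (begin
    + toℕ (residue a) - a               ≡⟨ cong (λ r → + r - a) (FinP.toℕ-fromℕ< _) ⟩
    + r - a                             ≡⟨ cong (λ x → + r - x) (a≡a%ℕn+[a/ℕn]*n a d) ⟩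
    + r - (+ r + (a /ℕ d) * + d)        ≡⟨ cancel (+ r) (a /ℕ d) (+ d) ⟩
    - (a /ℕ d) * + d                    ∎))
    where
    open ≡-Reasoning
    r = a %ℕ d
    cancel : ∀ r q d → r - (r + q * d) ≡ - q * d
    cancel = solve-∀

  residue-toℕ : ∀ (i : Fin d) → residue (+ toℕ i) ≡ i
  residue-toℕ i = FinP.toℕ-injective (trans (FinP.toℕ-fromℕ< _) (m<n⇒m%n≡m (FinP.toℕ<n i)))

  residue-cong : ∀ {a b} → a ≡ b mod d → residue a ≡ residue b
  residue-cong {a} {b} a≡b = FinP.toℕ-injective
    (≡-mod-small⇒≡ (FinP.toℕ<n (residue a)) (FinP.toℕ<n (residue b))
      (≡-mod-trans (residue-≡-mod a) (≡-mod-trans a≡b (≡-mod-sym (residue-≡-mod b)))))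

  residue-≡⇒≡-mod : ∀ {a b} → residue a ≡ residue b → a ≡ b mod d
  residue-≡⇒≡-mod {a} {b} eq = ≡-mod-trans (≡-mod-sym (residue-≡-mod a))
    (subst (λ i → + toℕ i ≡ b mod d) (sym eq) (residue-≡-mod b))

-- {1, …, N} and {c, …, c + N − 1} are both complete residue systems modulo N.
module _ {N : ℕ} (P : ℤ → Set) (P-periodic : ∀ {a b} → a ≡ b mod N → P a → P b) (c : ℤ) where

  periodic-∀⇔ : (∀ i → 1 ≤ i → i ≤ N → P (+ i)) ⇔ (∀ (q : Fin N) → P (+ toℕ q + c))
  periodic-∀⇔ = mk⇔ forward backward
    where
    forward : (∀ i → 1 ≤ i → i ≤ N → P (+ i)) → ∀ (q : Fin N) → P (+ toℕ q + c)
    forward P-on-1…N q = P-periodic i≡q+c (P-on-1…N (suc (toℕ t)) (s≤s z≤n) (FinP.toℕ<n t))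
      where
      instance _ = FinP.nonZeroIndex q
      t = residue N (+ toℕ q + c - + 1)
      decrement-increment : ∀ x → + 1 + (x - + 1) ≡ x
      decrement-increment = solve-∀
      i≡q+c : + suc (toℕ t) ≡ + toℕ q + c mod N
      i≡q+c = ≡-mod-trans (≡-mod-+ (≡-mod-refl {a = + 1}) (residue-≡-mod N (+ toℕ q + c - + 1)))
                          (≡-mod-reflexive (decrement-increment (+ toℕ q + c)))
    backward : (∀ (q : Fin N) → P (+ toℕ q + c)) → ∀ i → 1 ≤ i → i ≤ N → P (+ i)
    backward P-on-c…c+N i 1≤i i≤N = P-periodic q+c≡i (P-on-c…c+N q)
      where
      instance _ = ℕ.>-nonZero (ℕP.≤-trans 1≤i i≤N)
      q = residue N (+ i - c)
      subtract-add : ∀ x c → x - c + c ≡ x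
      subtract-add = solve-∀
      q+c≡i : + toℕ q + c ≡ + i mod N
      q+c≡i = ≡-mod-trans (≡-mod-+ (residue-≡-mod N (+ i - c)) (≡-mod-refl {a = c}))
                          (≡-mod-reflexive (subtract-add (+ i) c))

toℤ : (M : Modulus) → ZMod M → ℤ
toℤ (fin m) i = + toℕ i
toℤ ∞       i = i

fromℤ : (M : Modulus) → ℤ → ZMod M
fromℤ (fin m) = residue m
fromℤ ∞       a = a

fromℤ-toℤ : ∀ M i → fromℤ M (toℤ M i) ≡ i
fromℤ-toℤ (fin m) = residue-toℕ m
fromℤ-toℤ ∞       i = refl

fromℤ-≡⇔ShiftCond : ∀ M {a b} → fromℤ M a ≡ fromℤ M b ⇔ ShiftCond M (a - b)
fromℤ-≡⇔ShiftCond (fin m) {a} {b} =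
  mk⇔ (≡mod⇒∣ ∘ residue-≡⇒≡-mod m {a} {b}) (residue-cong m {a} {b} ∘ ∣⇒≡mod)
fromℤ-≡⇔ShiftCond ∞ {a} {b} = mk⇔ ℤP.i≡j⇒i-j≡0 (ℤP.i-j≡0⇒i≡j a b)

-- For M = fin m this uses that  residue m (+ n)  and  n mod m  are definitionally equal.
fromℤ-suc : ∀ M a → fromℤ M (a + + 1) ≡ sucMod M (fromℤ M a)
fromℤ-suc (fin m) a = residue-cong m (≡-mod-trans (≡-mod-reflexive (ℤP.+-comm a (+ 1)))
                        (≡-mod-+ (≡-mod-refl {a = + 1}) (≡-mod-sym (residue-≡-mod m a))))
fromℤ-suc ∞       a = ℤP.+-comm a (+ 1)

tabulate-∷ʳ : ∀ {A : Set} n (f : Fin (suc n) → A) → tabulate f ≡ tabulate (f ∘ inject₁) ∷ʳ f (fromℕ n)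
tabulate-∷ʳ zero    f = refl
tabulate-∷ʳ (suc n) f = cong (f Fin.zero ∷_) (tabulate-∷ʳ n (f ∘ Fin.suc))

tabulate-injective : ∀ {A : Set} {n} {f g : Fin n → A} → tabulate f ≡ tabulate g → ∀ i → f i ≡ g i
tabulate-injective {f = f} {g} eq i =
  trans (sym (VecP.lookup∘tabulate f i)) (trans (cong (λ v → lookup v i) eq) (VecP.lookup∘tabulate g i))

module _ (N : ℕ) where

  lampSum-∷-≡ : ∀ {j p} r L → j ≡ p mod N → lampSum N ((j , r) ∷ L) p ≡ r + lampSum N L p
  lampSum-∷-≡ {j} {p} r L j≡p =
    cong (λ b → (if b then r else 0ℤ) + lampSum N L p) (dec-true (+ N ∣? j - p) (≡mod⇒∣ j≡p))

  lampSum-∷-≢ : ∀ {j p} r L → ¬ (j ≡ p mod N) → lampSum N ((j , r) ∷ L) p ≡ lampSum N L p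
  lampSum-∷-≢ {j} {p} r L j≢p =
    trans (cong (λ b → (if b then r else 0ℤ) + lampSum N L p) (dec-false (+ N ∣? j - p) (j≢p ∘ ∣⇒≡mod)))
          (ℤP.+-identityˡ (lampSum N L p))

  lampSum-periodic : ∀ L {p p′} → p ≡ p′ mod N → lampSum N L p ≡ lampSum N L p′
  lampSum-periodic []            p≡p′ = refl
  lampSum-periodic ((j , r) ∷ L) {p} {p′} p≡p′ with j ≡? p mod N
  ... | yes j≡p = begin
    lampSum N ((j , r) ∷ L) p   ≡⟨ lampSum-∷-≡ r L j≡p ⟩
    r + lampSum N L p           ≡⟨ cong (_+_ r) (lampSum-periodic L p≡p′) ⟩
    r + lampSum N L p′          ≡⟨ lampSum-∷-≡ r L (≡-mod-trans j≡p p≡p′) ⟨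
    lampSum N ((j , r) ∷ L) p′  ∎
    where open ≡-Reasoning
  ... | no j≢p = begin
    lampSum N ((j , r) ∷ L) p   ≡⟨ lampSum-∷-≢ r L j≢p ⟩
    lampSum N L p               ≡⟨ lampSum-periodic L p≡p′ ⟩
    lampSum N L p′              ≡⟨ lampSum-∷-≢ r L (j≢p ∘ λ j≡p′ → ≡-mod-trans j≡p′ (≡-mod-sym p≡p′)) ⟨
    lampSum N ((j , r) ∷ L) p′  ∎
    where open ≡-Reasoning

  lampSum-++ : ∀ A B p → lampSum N (A ++ B) p ≡ lampSum N A p + lampSum N B p
  lampSum-++ []            B p = sym (ℤP.+-identityˡ (lampSum N B p))
  lampSum-++ ((j , r) ∷ A) B p =
    trans (cong (_+_ lamp) (lampSum-++ A B p)) (sym (ℤP.+-assoc lamp (lampSum N A p) (lampSum N B p)))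
    where lamp = if Dec.does (+ N ∣? j - p) then r else 0ℤ

  lampSum-shift-inv : ∀ m L m′ p →
    lampSum N (shiftLamps m (proj₁ (inv (L , m′)))) p ≡ - lampSum N L (p - m + m′)
  lampSum-shift-inv m []            m′ p = refl
  lampSum-shift-inv m ((j , r) ∷ L) m′ p =
    trans (cong₂ _+_ (trans (cong (λ b → if b then - r else 0ℤ) same-test) (negate-if (Dec.does test)))
                     (lampSum-shift-inv m L m′ p))
          (sym (ℤP.neg-distrib-+ (if Dec.does test then r else 0ℤ) (lampSum N L (p - m + m′))))
    where
    test = + N ∣? j - (p - m + m′)
    regroup : ∀ j m′ m p → (j - m′ + m) - p ≡ j - (p - m + m′)
    regroup = solve-∀
    same-test : Dec.does (+ N ∣? (j - m′ + m) - p) ≡ Dec.does test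
    same-test = cong (λ x → Dec.does (+ N ∣? x)) (regroup j m′ m p)
    negate-if : ∀ b → (if b then - r else 0ℤ) ≡ - (if b then r else 0ℤ)
    negate-if true  = refl
    negate-if false = refl

  lampSum-·inv : ∀ L m L′ m′ p →
    lampSum N (proj₁ ((L , m) · inv (L′ , m′))) p ≡ lampSum N L p - lampSum N L′ (p - m + m′)
  lampSum-·inv L m L′ m′ p =
    trans (lampSum-++ L _ p) (cong (_+_ (lampSum N L p)) (lampSum-shift-inv m L′ m′ p))

  lampSum-·gen-≡ : ∀ {k} L m (r : Fin k) {p} → m ≡ p mod N →
    lampSum N (proj₁ ((L , m) · gen r)) p ≡ lampSum N L p + + toℕ r
  lampSum-·gen-≡ L m r {p} m≡p =
    trans (lampSum-++ L _ p) (cong (_+_ (lampSum N L p))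
      (trans (lampSum-∷-≡ (+ toℕ r) [] (≡-mod-trans (≡-mod-reflexive (ℤP.+-identityˡ m)) m≡p))
             (ℤP.+-identityʳ (+ toℕ r))))

  lampSum-·gen-≢ : ∀ {k} L m (r : Fin k) {p} → ¬ (m ≡ p mod N) →
    lampSum N (proj₁ ((L , m) · gen r)) p ≡ lampSum N L p
  lampSum-·gen-≢ L m r {p} m≢p =
    trans (lampSum-++ L _ p) (trans (cong (_+_ (lampSum N L p))
      (lampSum-∷-≢ (+ toℕ r) [] (m≢p ∘ ≡-mod-trans (≡-mod-reflexive (sym (ℤP.+-identityˡ m))))))
      (ℤP.+-identityʳ (lampSum N L p)))

lampsFrom : ∀ {k n} → ℤ → Vec (Fin k) n → List (ℤ × ℤ)
lampsFrom a []       = []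
lampsFrom a (x ∷ xs) = (a , + toℕ x) ∷ lampsFrom (a + + 1) xs

module _ {k : ℕ} (N : ℕ) where

  lampSum-lampsFrom-gap : ∀ {n} (xs : Vec (Fin k) n) d a → suc d ℕ.+ n ≤ N →
    lampSum N (lampsFrom (+ suc d + a) xs) a ≡ 0ℤ
  lampSum-lampsFrom-gap []       d a _ = refl
  lampSum-lampsFrom-gap {suc n} (x ∷ xs) d a d+n<N =
    trans (lampSum-∷-≢ N (+ toℕ x) (lampsFrom (+ suc d + a + + 1) xs) d+a≢a)
          (trans (cong (λ b → lampSum N (lampsFrom b xs) a) (step (+ suc d) a))
                 (lampSum-lampsFrom-gap xs (suc d) a (subst (_≤ N) (ℕP.+-suc (suc d) n) d+n<N)))
    where
    step : ∀ d a → d + a + + 1 ≡ + 1 + d + a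
    step = solve-∀
    d+a≢a : ¬ (+ suc d + a ≡ a mod N)
    d+a≢a = ℕP.1+n≢0 ∘ ≡-mod-offset⇒≡0 (ℕP.<-≤-trans (ℕP.m<m+n (suc d) (s≤s z≤n)) d+n<N) ∘ ≡-mod-sym

  lampSum-lampsFrom : ∀ {n} (xs : Vec (Fin k) n) a → n ≤ N → (q : Fin n) →
    lampSum N (lampsFrom a xs) (+ toℕ q + a) ≡ + toℕ (lookup xs q)
  lampSum-lampsFrom (x ∷ xs) a n≤N Fin.zero = begin
    lampSum N (lampsFrom a (x ∷ xs)) (+ 0 + a)
      ≡⟨ lampSum-∷-≡ N (+ toℕ x) (lampsFrom (a + + 1) xs) (≡-mod-reflexive (sym (ℤP.+-identityˡ a))) ⟩
    + toℕ x + lampSum N (lampsFrom (a + + 1) xs) (+ 0 + a)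
      ≡⟨ cong₂ (λ b p → + toℕ x + lampSum N (lampsFrom b xs) p) (ℤP.+-comm a (+ 1)) (ℤP.+-identityˡ a) ⟩
    + toℕ x + lampSum N (lampsFrom (+ 1 + a) xs) a
      ≡⟨ cong (_+_ (+ toℕ x)) (lampSum-lampsFrom-gap xs 0 a n≤N) ⟩
    + toℕ x + 0ℤ
      ≡⟨ ℤP.+-identityʳ (+ toℕ x) ⟩
    + toℕ x
      ∎
    where open ≡-Reasoning
  lampSum-lampsFrom (x ∷ xs) a n≤N (Fin.suc q) =
    trans (lampSum-∷-≢ N (+ toℕ x) (lampsFrom (a + + 1) xs) a≢q+1+a)
          (trans (cong (lampSum N (lampsFrom (a + + 1) xs)) (step (+ toℕ q) a))
                 (lampSum-lampsFrom xs (a + + 1) (ℕP.≤-trans (ℕP.n≤1+n _) n≤N) q))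
    where
    step : ∀ q a → + 1 + q + a ≡ q + (a + + 1)
    step = solve-∀
    a≢q+1+a : ¬ (a ≡ + suc (toℕ q) + a mod N)
    a≢q+1+a = ℕP.1+n≢0 ∘ ≡-mod-offset⇒≡0 (ℕP.<-≤-trans (FinP.toℕ<n (Fin.suc q)) n≤N)

module _ (k : ℕ) .{{_ : NonZero k}} where

  window : (N : ℕ) → LWord → Vec (Fin k) N
  window N (L , m) = tabulate (λ q → residue k (lampSum N L (+ toℕ q + m)))

  -- The lamp under the lighter; 0 for the empty window (N = 0).
  firstLamp : ∀ {n} → Vec (Fin k) n → ℤ
  firstLamp []      = 0ℤ
  firstLamp (x ∷ _) = + toℕ x

  -- The generator c^r b appends  letter x r  to the window x (window-·gen).
  letter : ∀ {n} → Vec (Fin k) n → Fin k → Fin k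
  letter x r = residue k (firstLamp x + + toℕ r)

  label : ∀ {n} → Vec (Fin k) n → Fin k → Fin k
  label x y = residue k (+ toℕ y - firstLamp x)

  letter-label : ∀ {n} (x : Vec (Fin k) n) y → letter x (label x y) ≡ y
  letter-label x y = trans (residue-cong k (≡-mod-trans
      (≡-mod-+ (≡-mod-refl {a = firstLamp x}) (residue-≡-mod k (+ toℕ y - firstLamp x)))
      (≡-mod-reflexive (add-sub (firstLamp x) (+ toℕ y)))))
    (residue-toℕ k y)
    where
    add-sub : ∀ a y → a + (y - a) ≡ y
    add-sub = solve-∀

  label-letter : ∀ {n} (x : Vec (Fin k) n) r → label x (letter x r) ≡ r
  label-letter x r = trans (residue-cong k (≡-mod-trans
      (≡-mod-+ (residue-≡-mod k (firstLamp x + + toℕ r)) (≡-mod-refl {a = - firstLamp x}))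
      (≡-mod-reflexive (sub-add (firstLamp x) (+ toℕ r)))))
    (residue-toℕ k r)
    where
    sub-add : ∀ a r → a + r - a ≡ r
    sub-add = solve-∀

  -- Only the last entry sees the new lamp: it sits at position m ≡ m + 1 + (N − 1).
  window-·gen : ∀ N L m (r : Fin k) →
    window N ((L , m) · gen r) ≡ shiftIn (window N (L , m)) (letter (window N (L , m)) r)
  window-·gen zero    L m r = refl
  window-·gen (suc n) L m r = trans (tabulate-∷ʳ n G) (cong₂ _∷ʳ_ (VecP.tabulate-cong moved) wrapped)
    where
    N = suc n
    F G : Fin N → Fin k
    F q = residue k (lampSum N L (+ toℕ q + m))
    G q = residue k (lampSum N (proj₁ ((L , m) · gen r)) (+ toℕ q + (m + + 1)))
    regroup : ∀ q m → q + (m + + 1) ≡ + 1 + q + m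
    regroup = solve-∀

    moved : ∀ j → G (inject₁ j) ≡ F (Fin.suc j)
    moved j = cong (residue k) (trans (lampSum-·gen-≢ N L m r m≢p) (cong (lampSum N L) p≡j+1+m))
      where
      p≡j+1+m : + toℕ (inject₁ j) + (m + + 1) ≡ + suc (toℕ j) + m
      p≡j+1+m = trans (cong (λ t → + t + (m + + 1)) (FinP.toℕ-inject₁ j)) (regroup (+ toℕ j) m)
      m≢p : ¬ (m ≡ + toℕ (inject₁ j) + (m + + 1) mod N)
      m≢p = ℕP.1+n≢0 ∘ ≡-mod-offset⇒≡0 (s≤s (FinP.toℕ<n j)) ∘ subst (λ p → m ≡ p mod N) p≡j+1+m

    p≡N+m : + toℕ (fromℕ n) + (m + + 1) ≡ + N + m
    p≡N+m = trans (cong (λ t → + t + (m + + 1)) (FinP.toℕ-fromℕ n)) (regroup (+ n) m)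
    p≡m : + toℕ (fromℕ n) + (m + + 1) ≡ m mod N
    p≡m = ≡-mod-trans (≡-mod-reflexive p≡N+m) (+-period-≡-mod m)
    p≡0+m : + toℕ (fromℕ n) + (m + + 1) ≡ + 0 + m mod N
    p≡0+m = ≡-mod-trans p≡m (≡-mod-reflexive (sym (ℤP.+-identityˡ m)))

    wrapped : G (fromℕ n) ≡ residue k (+ toℕ (F Fin.zero) + + toℕ r)
    wrapped = residue-cong k (≡-mod-trans (≡-mod-reflexive (begin
      lampSum N (proj₁ ((L , m) · gen r)) (+ toℕ (fromℕ n) + (m + + 1))
        ≡⟨ lampSum-·gen-≡ N L m r (≡-mod-sym p≡m) ⟩
      lampSum N L (+ toℕ (fromℕ n) + (m + + 1)) + + toℕ r
        ≡⟨ cong (_+ + toℕ r) (lampSum-periodic N L p≡0+m) ⟩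
      lampSum N L (+ 0 + m) + + toℕ r
        ∎))
      (≡-mod-+ (≡-mod-sym (residue-≡-mod k (lampSum N L (+ 0 + m)))) (≡-mod-refl {a = + toℕ r})))
      where open ≡-Reasoning

module _ (k : ℕ) .{{_ : NonZero k}} (N : ℕ) (M : Modulus) where

  vertexOf : LWord → SWVertex k N M
  vertexOf (L , m) = window k N (L , m) , fromℤ M m

  wordOf : SWVertex k N M → LWord
  wordOf (x , i) = lampsFrom (toℤ M i) x , toℤ M i

  vertexOf-wordOf : ∀ v → vertexOf (wordOf v) ≡ v
  vertexOf-wordOf (x , i) =
    cong₂ _,_ (trans (VecP.tabulate-cong lamp) (VecP.tabulate∘lookup x)) (fromℤ-toℤ M i)
    where
    lamp : ∀ q → residue k (lampSum N (lampsFrom (toℤ M i) x) (+ toℕ q + toℤ M i)) ≡ lookup x q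
    lamp q = trans (cong (residue k) (lampSum-lampsFrom N x (toℤ M i) ℕP.≤-refl q))
                   (residue-toℕ k (lookup x q))

  sameCoset⇔sameVertex : ∀ g h → SameCoset k N M g h ⇔ vertexOf g ≡ vertexOf h
  sameCoset⇔sameVertex (L , m) (L′ , m′) = mk⇔
    (λ (shift , lamps) → cong₂ _,_ (VecP.tabulate-cong (λ q → to (pointwise q) (to allLamps lamps q)))
                                   (from (fromℤ-≡⇔ShiftCond M) shift))
    (λ eq → to (fromℤ-≡⇔ShiftCond M) (cong proj₂ eq)
          , from allLamps (λ q → from (pointwise q) (tabulate-injective (cong proj₁ eq) q)))
    where
    gh⁻¹ = proj₁ ((L , m) · inv (L′ , m′))
    Off : ℤ → Set
    Off p = + k ∣ lampSum N gh⁻¹ p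
    allLamps = periodic-∀⇔ Off (λ p≡p′ → subst (+ k ∣_) (lampSum-periodic N gh⁻¹ p≡p′)) m
    pointwise : ∀ (q : Fin N) → Off (+ toℕ q + m) ⇔
      residue k (lampSum N L (+ toℕ q + m)) ≡ residue k (lampSum N L′ (+ toℕ q + m′))
    pointwise q = mk⇔
      (λ off → residue-cong k {here} {there} (∣⇒≡mod (subst (+ k ∣_) difference off)))
      (λ same → subst (+ k ∣_) (sym difference) (≡mod⇒∣ (residue-≡⇒≡-mod k {here} {there} same)))
      where
      here there : ℤ
      here  = lampSum N L (+ toℕ q + m)
      there = lampSum N L′ (+ toℕ q + m′)
      cancel : ∀ q m m′ → q + m - m + m′ ≡ q + m′
      cancel = solve-∀
      difference : lampSum N gh⁻¹ (+ toℕ q + m) ≡ here - there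
      difference = trans (lampSum-·inv N L m L′ m′ (+ toℕ q + m))
        (cong (λ p → here - lampSum N L′ p) (cancel (+ toℕ q) m m′))

  sameCoset-refl : ∀ g → SameCoset k N M g g
  sameCoset-refl g = from (sameCoset⇔sameVertex g g) refl

  wordOf-vertexOf : ∀ g → SameCoset k N M (wordOf (vertexOf g)) g
  wordOf-vertexOf g = from (sameCoset⇔sameVertex (wordOf (vertexOf g)) g) (vertexOf-wordOf (vertexOf g))

  wordOf-·gen-label : ∀ x i y →
    SameCoset k N M (wordOf (x , i) · gen (label k x y)) (wordOf (shiftIn x y , sucMod M i))
  wordOf-·gen-label x i y =
    from (sameCoset⇔sameVertex (wordOf (x , i) · gen r) (wordOf (shiftIn x y , sucMod M i))) (begin
      vertexOf (wordOf (x , i) · gen r)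
        ≡⟨ cong₂ _,_ (window-·gen k N (lampsFrom (toℤ M i) x) (toℤ M i) r) (fromℤ-suc M (toℤ M i)) ⟩
      (shiftIn (proj₁ v) (letter k (proj₁ v) r) , sucMod M (proj₂ v))
        ≡⟨ cong (λ (x′ , i′) → shiftIn x′ (letter k x′ r) , sucMod M i′) (vertexOf-wordOf (x , i)) ⟩
      (shiftIn x (letter k x r) , sucMod M i)
        ≡⟨ cong (λ z → shiftIn x z , sucMod M i) (letter-label k x y) ⟩
      (shiftIn x y , sucMod M i)
        ≡⟨ vertexOf-wordOf (shiftIn x y , sucMod M i) ⟨
      vertexOf (wordOf (shiftIn x y , sucMod M i))
        ∎)
    where
    open ≡-Reasoning
    r = label k x y
    v = vertexOf (wordOf (x , i))

  spiderWeb≅Schreier : OrientedIso (SW k N M) (Sch k N M)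
  spiderWeb≅Schreier = record
    { φ        = wordOf
    ; φ⁻¹      = vertexOf
    ; φ-cong   = λ { {v} refl → sameCoset-refl (wordOf v) }
    ; φ⁻¹-cong = λ {g} {h} → to (sameCoset⇔sameVertex g h)
    ; φ⁻¹∘φ    = vertexOf-wordOf
    ; φ∘φ⁻¹    = wordOf-vertexOf
    ; ε        = λ { (v@(x , _) , y) → wordOf v , label k x y }
    ; ε⁻¹      = λ { (g , r) → vertexOf g , letter k (proj₁ (vertexOf g)) r }
    ; ε-cong   = λ { {(v , _)} refl → sameCoset-refl (wordOf v) , refl }
    ; ε⁻¹-cong = λ { {(g , r)} {(h , _)} (same , refl) →
                     cong (λ v → v , letter k (proj₁ v) r) (to (sameCoset⇔sameVertex g h) same) }
    ; ε⁻¹∘ε    = λ { ((x , i) , y) →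
                     trans (cong (λ v → v , letter k (proj₁ v) (label k x y)) (vertexOf-wordOf (x , i)))
                           (cong ((x , i) ,_) (letter-label k x y)) }
    ; ε∘ε⁻¹    = λ { (g , r) → wordOf-vertexOf g , label-letter k (proj₁ (vertexOf g)) r }
    ; ε-src    = λ { (v , _) → sameCoset-refl (wordOf v) }
    ; ε-tgt    = λ { ((x , i) , y) → wordOf-·gen-label x i y }
    }

theorem6p3 : (k : ℕ) → 2 ≤ k → (M : Modulus) → (N : ℕ) → WeakIso (SW k N M) (Sch k N M)
theorem6p3 k 2≤k M N =
  orientedIso⇒weakIso (spiderWeb≅Schreier k N M) (λ (g , _) → sameCoset-refl k N M g , refl)
  where instance _ = ℕ.>-nonZero (ℕP.<-≤-trans (s≤s z≤n) 2≤k)
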